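{- Let $\alpha,\beta$ be relatively prime positive integers. For all positive integers $n$ with $s(n)>2$, $$\tfrac12\log_\gamma(n)-1\le s(n)\le\log_\gamma(n)+2.$$ Moreover, in the case $\alpha=\beta=1$, for such $n$ we have $s^{1,1}(n)\ge\frac12\log_\phi(n)+2$, where $\phi=\frac{1+\sqrt5}{2}$ is the golden ratio.
   Context: For positive integers $a_1,a_2$, the $(\alpha,\beta)$-walk $w_k(a_1,a_2)$ is the sequence with $w_1=a_1$, $w_2=a_2$, $w_{k+2}=\alpha w_{k+1}+\beta w_k$ for $k\ge1$. For a positive integer $n$, $s(n;a_1,a_2)$ is the (largest) index $s$ with $w_s(a_1,a_2)=n$ ($-\infty$ if none), and $s(n)=s^{\alpha,\beta}(n)=\max_{a_1,a_2\ge1}s(n;a_1,a_2)$. Let $\gamma=\frac12(\alpha+\sqrt{\alpha^2+4\beta})$. -}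

module Defs where

open import Data.Nat as ℕ using (ℕ; zero; suc)
open import Data.Integer as ℤ using (ℤ; +_; 0ℤ; 1ℤ)
open import Data.Product using (Σ; _×_; _,_; ∃)
open import Data.Sum using (_⊎_)
open import Relation.Binary.PropositionalEquality using (_≡_)

-- The (α,β)-walk: walk α β a₁ a₂ k = w_k(a₁,a₂) for k ≥ 1
-- (index 0 is unused; we set it to 0 so it never equals a positive n).
walk : ℕ → ℕ → ℕ → ℕ → ℕ → ℕ
walk α β a₁ a₂ zero = 0
walk α β a₁ a₂ (suc zero) = a₁
walk α β a₁ a₂ (suc (suc zero)) = a₂
walk α β a₁ a₂ (suc (suc (suc k))) =
  α ℕ.* walk α β a₁ a₂ (suc (suc k)) ℕ.+ β ℕ.* walk α β a₁ a₂ (suc k)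

IsS : ℕ → ℕ → ℕ → ℕ → Set
IsS α β n s =
  (Σ ℕ λ a₁ → Σ ℕ λ a₂ → 1 ℕ.≤ a₁ × 1 ℕ.≤ a₂ × 1 ℕ.≤ s × walk α β a₁ a₂ s ≡ n)
  × (∀ a₁ a₂ k → 1 ℕ.≤ a₁ → 1 ℕ.≤ a₂ → 1 ℕ.≤ k → walk α β a₁ a₂ k ≡ n → k ℕ.≤ s)

-- Exact real arithmetic in ℤ[γ] ⊂ ℝ, where γ = (α + √(α²+4β))/2 is the
-- positive root of x² = αx + β.  A pair (a , b) denotes the real a + bγ.
Zγ : Set
Zγ = ℤ × ℤ

γ-mul : ℕ → ℕ → Zγ → Zγ → Zγ
γ-mul α β (a , b) (c , d) =
  (a ℤ.* c ℤ.+ (+ β) ℤ.* b ℤ.* d , a ℤ.* d ℤ.+ b ℤ.* c ℤ.+ (+ α) ℤ.* b ℤ.* d)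

γ^ : ℕ → ℕ → ℕ → Zγ
γ^ α β zero = (1ℤ , 0ℤ)
γ^ α β (suc k) = γ-mul α β (0ℤ , 1ℤ) (γ^ α β k)

-- a + bγ ≥ 0 (as a real number).  Uses: for x > 0, x ≤ γ ⟺ x² ≤ αx + β,
-- since γ is the unique positive root of x² - αx - β (α, β ≥ 1).
NonNeg : ℕ → ℕ → Zγ → Set
NonNeg α β (a , b) =
  (b ≡ 0ℤ × 0ℤ ℤ.≤ a)
  ⊎ (0ℤ ℤ.< b × (0ℤ ℤ.≤ a ⊎ a ℤ.* a ℤ.≤ (+ β) ℤ.* b ℤ.* b ℤ.- (+ α) ℤ.* a ℤ.* b))
  ⊎ (b ℤ.< 0ℤ × 0ℤ ℤ.≤ a × (+ β) ℤ.* b ℤ.* b ℤ.- (+ α) ℤ.* a ℤ.* b ℤ.≤ a ℤ.* a)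

_≤[_,_]_ : Zγ → ℕ → ℕ → Zγ → Set
(a , b) ≤[ α , β ] (c , d) = NonNeg α β (c ℤ.- a , d ℤ.- b)

ι : ℕ → Zγ
ι n = (+ n , 0ℤ)

{-# OPTIONS --safe #-}

-- Every walk is w_{k+2}(a₁,a₂) = β U_k a₁ + U_{k+1} a₂ for the Lucas sequence U (U₀ = 0, U₁ = 1),
-- and γ^{k+1} = β U_k + U_{k+1} γ.  Since β U_k and U_{k+1} are coprime, every n > β U_k U_{k+1}
-- is a combination of them with positive coefficients, i.e. it is hit at index k + 2; maximality
-- of s therefore gives n ≤ β U_{s−1} U_s ≤ U_{2s}, while n = w_s(a₁,a₂) ≥ w_s(1,1).  Comparing a
-- natural number with P + Qγ reduces to comparing c with γQ, i.e. c² with βQ² + αcQ.  For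
-- α = β = 1 the sharper bound is F_{t+2} F_{t+3} = F_{2t+1} + F_{2t+2} + F_t F_{t+1} ≤ φ^{2t+2}.

module Submission where

open import Defs
open import Data.Nat using (ℕ; zero; suc; _≤_; _<_; _*_; _+_; _∸_; z≤n; s≤s; NonZero; >-nonZero)
open import Data.Nat.Properties
open import Data.Nat.DivMod using (_/_; _%_; m≡m%n+[m/n]*n; m%n<n)
open import Data.Nat.Divisibility
  using (_∣_; divides; quotient; m∣n⇒n≡quotient*m; ∣-trans; ∣1⇒≡1; ∣m+n∣m⇒∣n; ∣n⇒∣m*n; m∣m*n; n∣m*n)
open import Data.Nat.Coprimality as Coprime using (Coprime; coprime-Bézout; coprime-divisor)
open import Data.Nat.GCD using (module Bézout)
open import Data.Nat.Tactic.RingSolver using (solve; solve-∀)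
open import Data.Integer as ℤ using (+_; 0ℤ; 1ℤ; _⊖_; +≤+; +<+)
open import Data.Integer.Properties as ℤ using (pos-+; pos-*; m-n≡m⊖n; ⊖-≥; ⊖-≤)
import Data.Integer.Tactic.RingSolver as ℤ-Ring
open import Data.List using (_∷_; [])
open import Data.Product using (_×_; _,_; ∃; ∃₂)
open import Data.Sum using (inj₁; inj₂)
open import Relation.Binary.PropositionalEquality
open import Relation.Nullary using (¬_)

coprime-* : ∀ {m n o} → Coprime m o → Coprime n o → Coprime (m * n) o
coprime-* {m} m⊥o n⊥o {d} (d∣mn , d∣o) = n⊥o (coprime-divisor d⊥m d∣mn , d∣o)
  where
  d⊥m : Coprime d m
  d⊥m (i∣d , i∣m) = m⊥o (i∣m , ∣-trans i∣d d∣o)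

coprime⇒∃[a]y∣x*a+1 : ∀ {x y} .{{_ : NonZero y}} → Coprime x y → ∃ λ a → y ∣ x * a + 1
coprime⇒∃[a]y∣x*a+1 {x} {y@(suc y₀)} x⊥y with coprime-Bézout x⊥y
... | Bézout.-+ a c 1+ax≡cy = a , divides c (trans (trans (+-comm (x * a) 1) (cong suc (*-comm x a))) 1+ax≡cy)
... | Bézout.+- a b 1+by≡ax = a * y₀ , divides (1 + b * y₀) (begin
  x * (a * y₀) + 1         ≡⟨ solve (x ∷ a ∷ y₀ ∷ []) ⟩
  (a * x) * y₀ + 1         ≡⟨ cong (λ z → z * y₀ + 1) 1+by≡ax ⟨
  (1 + b * y) * y₀ + 1     ≡⟨ solve (b ∷ y₀ ∷ []) ⟩
  (1 + b * y₀) * y         ∎)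
  where open ≡-Reasoning

coprime⇒∃[r<y]y∣x*r+n : ∀ {x y} .{{_ : NonZero y}} → Coprime x y → ∀ n → ∃ λ r → r < y × y ∣ x * r + n
coprime⇒∃[r<y]y∣x*r+n {x} {y} x⊥y n with coprime⇒∃[a]y∣x*a+1 x⊥y
... | a , y∣xa+1 with n * a % y | n * a / y | m%n<n (n * a) y | m≡m%n+[m/n]*n (n * a) y
... | r | q | r<y | na≡r+qy = r , r<y , ∣m+n∣m⇒∣n y∣xqy+[xr+n] (n∣m*n (x * q))
  where
  open ≡-Reasoning
  y∣xqy+[xr+n] : y ∣ x * q * y + (x * r + n)
  y∣xqy+[xr+n] = subst (y ∣_) (begin
    n * (x * a + 1)          ≡⟨ solve (n ∷ x ∷ a ∷ []) ⟩
    x * (n * a) + n          ≡⟨ cong (λ z → x * z + n) na≡r+qy ⟩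
    x * (r + q * y) + n      ≡⟨ solve (x ∷ r ∷ q ∷ y ∷ n ∷ []) ⟩
    x * q * y + (x * r + n)  ∎) (∣n⇒∣m*n n y∣xa+1)

-- For r < y with x r ≡ −n (mod y), b₁ = y − r ∈ [1, y] has x b₁ ≡ n (mod y) and n − x b₁ > n − x y > 0.
coprime-positive-combination : ∀ {x y n} .{{_ : NonZero y}} → Coprime x y → x * y < n →
  ∃₂ λ b₁ b₂ → 1 ≤ b₁ × 1 ≤ b₂ × x * b₁ + y * b₂ ≡ n
coprime-positive-combination {x} {y} x⊥y xy<n with m≤n⇒∃[o]m+o≡n xy<n
... | e , refl with coprime⇒∃[r<y]y∣x*r+n x⊥y (suc (x * y) + e)
... | r , r<y , y∣xr+n with m≤n⇒∃[o]m+o≡n r<y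
... | o , refl = suc o , b₂ , s≤s z≤n , 1≤b₂ , combination
  where
  open ≡-Reasoning
  regroup : x * r + (suc (x * y) + e) ≡ x * y + (x * r + suc e)
  regroup = solve (x ∷ r ∷ o ∷ e ∷ [])
  y∣xr+1+e : y ∣ x * r + suc e
  y∣xr+1+e = ∣m+n∣m⇒∣n (subst (y ∣_) regroup y∣xr+n) (n∣m*n x)
  b₂ : ℕ
  b₂ = quotient y∣xr+1+e
  xr+1+e≡b₂y : x * r + suc e ≡ b₂ * y
  xr+1+e≡b₂y = m∣n⇒n≡quotient*m y∣xr+1+e
  1≤b₂ : 1 ≤ b₂
  1≤b₂ = *-cancelʳ-< y 0 b₂ (subst (0 <_) xr+1+e≡b₂y (≤-trans (s≤s z≤n) (m≤n+m (suc e) (x * r))))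
  combination : x * suc o + y * b₂ ≡ suc (x * y) + e
  combination = begin
    x * suc o + y * b₂            ≡⟨ cong (_+_ (x * suc o)) (trans (*-comm y b₂) (sym xr+1+e≡b₂y)) ⟩
    x * suc o + (x * r + suc e)   ≡⟨ solve (x ∷ r ∷ o ∷ e ∷ []) ⟩
    suc (x * y) + e               ∎

pos-*-* : ∀ a b c → + (a * b * c) ≡ + a ℤ.* + b ℤ.* + c
pos-*-* a b c = trans (pos-* (a * b) c) (cong (λ z → z ℤ.* + c) (pos-* a b))

module _ (α β : ℕ) where

  U : ℕ → ℕ
  U zero = 0
  U (suc zero) = 1
  U (suc (suc k)) = α * U (suc k) + β * U k

  Recurrent : (ℕ → ℕ) → Set
  Recurrent f = ∀ k → f (suc (suc k)) ≡ α * f (suc k) + β * f k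

  recurrent⇒U-expansion : ∀ {f} → Recurrent f → ∀ k → f (suc k) ≡ β * U k * f 0 + U (suc k) * f 1
  recurrent⇒U-expansion {f} _ zero = expand-1 (f 0) (f 1)
    where
    expand-1 : ∀ x y → y ≡ β * 0 * x + 1 * y
    expand-1 x y = solve (β ∷ x ∷ y ∷ [])
  recurrent⇒U-expansion {f} rec (suc k) = begin
    f (suc (suc k))                                  ≡⟨ recurrent⇒U-expansion (λ j → rec (suc j)) k ⟩
    β * U k * f 1 + U (suc k) * f 2                  ≡⟨ cong (λ z → β * U k * f 1 + U (suc k) * z) (rec 0) ⟩
    β * U k * f 1 + U (suc k) * (α * f 1 + β * f 0)  ≡⟨ regroup (U k) (U (suc k)) (f 0) (f 1) ⟩
    β * U (suc k) * f 0 + U (suc (suc k)) * f 1      ∎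
    where
    open ≡-Reasoning
    regroup : ∀ u v x y → β * u * y + v * (α * y + β * x) ≡ β * v * x + (α * v + β * u) * y
    regroup u v x y = solve (α ∷ β ∷ u ∷ v ∷ x ∷ y ∷ [])

  walk≡U-expansion : ∀ a₁ a₂ k → walk α β a₁ a₂ (suc (suc k)) ≡ β * U k * a₁ + U (suc k) * a₂
  walk≡U-expansion a₁ a₂ = recurrent⇒U-expansion {λ k → walk α β a₁ a₂ (suc k)} (λ _ → refl)

  U-addition : ∀ j m → U (suc j + m) ≡ β * U j * U m + U (suc j) * U (suc m)
  U-addition j m = recurrent⇒U-expansion {λ i → U (i + m)} (λ _ → refl) j

  β*U*U≤U : ∀ k → β * U k * U (suc k) ≤ U (suc k + suc k)
  β*U*U≤U k = ≤-trans (m≤m+n _ _) (≤-reflexive (sym (U-addition k (suc k))))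

  γ·[p+qγ] : ∀ p q → γ-mul α β (0ℤ , 1ℤ) (+ p , + q) ≡ (+ (β * q) , + (α * q + p))
  γ·[p+qγ] p q = cong₂ _,_
    (trans (real-part (+ p) (+ β) (+ q)) (sym (pos-* β q)))
    (trans (γ-part (+ p) (+ q) (+ α)) (sym (trans (pos-+ (α * q) p) (cong (λ z → z ℤ.+ + p) (pos-* α q)))))
    where
    real-part : ∀ p b q → 0ℤ ℤ.* p ℤ.+ b ℤ.* 1ℤ ℤ.* q ≡ b ℤ.* q
    real-part = ℤ-Ring.solve-∀
    γ-part : ∀ p q a → 0ℤ ℤ.* q ℤ.+ 1ℤ ℤ.* p ℤ.+ a ℤ.* 1ℤ ℤ.* q ≡ a ℤ.* q ℤ.+ p
    γ-part = ℤ-Ring.solve-∀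

  γ^≡U : ∀ k → γ^ α β (suc k) ≡ (+ (β * U k) , + U (suc k))
  γ^≡U zero = trans (γ·[p+qγ] 1 0) (cong (λ z → (+ (β * 0) , + (z + 1))) (*-zeroʳ α))
  γ^≡U (suc k) = trans (cong (γ-mul α β (0ℤ , 1ℤ)) (γ^≡U k)) (γ·[p+qγ] (β * U k) (U (suc k)))

  -- As γ is the positive root of x² = αx + β, for naturals c and Q these encode c ≤ γQ and
  -- (when β ≥ 1) γQ ≤ c.
  infix 4 _≤γ·_ _γ·≤_
  _≤γ·_ : ℕ → ℕ → Set
  c ≤γ· Q = c * c ≤ β * Q * Q + α * c * Q

  _γ·≤_ : ℕ → ℕ → Set
  Q γ·≤ c = β * Q * Q + α * c * Q ≤ c * c

  ≤-≤γ·-trans : ∀ {d c Q} → d ≤ c → c ≤γ· Q → d ≤γ· Q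
  ≤-≤γ·-trans {d} {c} {Q} d≤c c≤γQ with ≤-total d (α * Q)
  ... | inj₁ d≤αQ = begin
    d * d                   ≤⟨ *-monoʳ-≤ d d≤αQ ⟩
    d * (α * Q)             ≡⟨ solve (α ∷ d ∷ Q ∷ []) ⟩
    α * d * Q               ≤⟨ m≤n+m _ _ ⟩
    β * Q * Q + α * d * Q   ∎
    where open ≤-Reasoning
  ... | inj₂ αQ≤d with m≤n⇒∃[o]m+o≡n d≤c
  ...   | f , refl = +-cancelʳ-≤ (α * f * Q) (d * d) (β * Q * Q + α * d * Q) (begin
    d * d + α * f * Q                    ≤⟨ +-monoʳ-≤ (d * d) αfQ≤ ⟩
    d * d + (d * f + (d * f + f * f))    ≡⟨ solve (d ∷ f ∷ []) ⟩
    (d + f) * (d + f)                    ≤⟨ c≤γQ ⟩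
    β * Q * Q + α * (d + f) * Q          ≡⟨ solve (α ∷ β ∷ d ∷ f ∷ Q ∷ []) ⟩
    β * Q * Q + α * d * Q + α * f * Q    ∎)
    where
    open ≤-Reasoning
    αfQ≤ : α * f * Q ≤ d * f + (d * f + f * f)
    αfQ≤ = begin
      α * f * Q                   ≡⟨ solve (α ∷ f ∷ Q ∷ []) ⟩
      α * Q * f                   ≤⟨ *-monoˡ-≤ f αQ≤d ⟩
      d * f                       ≤⟨ m≤m+n _ _ ⟩
      d * f + (d * f + f * f)     ∎

  α*Q≤γ·Q : ∀ Q → α * Q ≤γ· Q
  α*Q≤γ·Q Q = begin
    α * Q * (α * Q)                   ≡⟨ solve (α ∷ Q ∷ []) ⟩
    α * (α * Q) * Q                   ≤⟨ m≤n+m _ _ ⟩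
    β * Q * Q + α * (α * Q) * Q       ∎
    where open ≤-Reasoning

  [α+β]*Q≤⇒γ·≤ : ∀ {Q c} → 1 ≤ α + β → (α + β) * Q ≤ c → Q γ·≤ c
  [α+β]*Q≤⇒γ·≤ {Q} {c} 1≤α+β [α+β]Q≤c = begin
    β * Q * Q + α * c * Q     ≤⟨ +-monoˡ-≤ (α * c * Q) (*-monoˡ-≤ Q (*-monoʳ-≤ β Q≤c)) ⟩
    β * c * Q + α * c * Q     ≡⟨ solve (α ∷ β ∷ c ∷ Q ∷ []) ⟩
    c * ((α + β) * Q)         ≤⟨ *-monoʳ-≤ c [α+β]Q≤c ⟩
    c * c                     ∎
    where
    open ≤-Reasoning
    Q≤c : Q ≤ c
    Q≤c = ≤-trans (m≤n*m Q (α + β) {{>-nonZero 1≤α+β}}) [α+β]Q≤c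

  pos-β*Q*Q+α*c*Q : ∀ c Q → + (β * Q * Q + α * c * Q) ≡ + β ℤ.* + Q ℤ.* + Q ℤ.+ + α ℤ.* + c ℤ.* + Q
  pos-β*Q*Q+α*c*Q c Q = trans (pos-+ (β * Q * Q) (α * c * Q)) (cong₂ ℤ._+_ (pos-*-* β Q Q) (pos-*-* α c Q))

  nonNeg-[Qγ−d] : ∀ {d Q} → 1 ≤ Q → d ≤γ· Q → NonNeg α β (ℤ.- + d , + Q)
  nonNeg-[Qγ−d] {d} {Q} 1≤Q d≤γQ = inj₂ (inj₁ (+<+ 1≤Q , inj₂ (subst₂ ℤ._≤_ lhs rhs (+≤+ d≤γQ))))
    where
    square-neg : ∀ x → x ℤ.* x ≡ ℤ.- x ℤ.* ℤ.- x
    square-neg = ℤ-Ring.solve-∀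
    negate : ∀ b q a x → b ℤ.* q ℤ.* q ℤ.+ a ℤ.* x ℤ.* q ≡ b ℤ.* q ℤ.* q ℤ.- a ℤ.* ℤ.- x ℤ.* q
    negate = ℤ-Ring.solve-∀
    lhs : + (d * d) ≡ ℤ.- + d ℤ.* ℤ.- + d
    lhs = trans (pos-* d d) (square-neg (+ d))
    rhs : + (β * Q * Q + α * d * Q) ≡ + β ℤ.* + Q ℤ.* + Q ℤ.- + α ℤ.* ℤ.- + d ℤ.* + Q
    rhs = trans (pos-β*Q*Q+α*c*Q d Q) (negate (+ β) (+ Q) (+ α) (+ d))

  nonNeg-[c−Qγ] : ∀ {c Q} → 1 ≤ Q → Q γ·≤ c → NonNeg α β (+ c , ℤ.- + Q)
  nonNeg-[c−Qγ] {c} {Q} 1≤Q Qγ≤c =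
    inj₂ (inj₂ (ℤ.neg-mono-< (+<+ 1≤Q) , +≤+ z≤n , subst₂ ℤ._≤_ lhs (pos-* c c) (+≤+ Qγ≤c)))
    where
    negate : ∀ b q a x →
      b ℤ.* q ℤ.* q ℤ.+ a ℤ.* x ℤ.* q ≡ b ℤ.* ℤ.- q ℤ.* ℤ.- q ℤ.- a ℤ.* x ℤ.* ℤ.- q
    negate = ℤ-Ring.solve-∀
    lhs : + (β * Q * Q + α * c * Q) ≡ + β ℤ.* ℤ.- + Q ℤ.* ℤ.- + Q ℤ.- + α ℤ.* + c ℤ.* ℤ.- + Q
    lhs = trans (pos-β*Q*Q+α*c*Q c Q) (negate (+ β) (+ Q) (+ α) (+ c))

  nonNeg⇒ι≤ : ∀ {N P Q a} → P ⊖ N ≡ a → NonNeg α β (a , + Q) → ι N ≤[ α , β ] (+ P , + Q)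
  nonNeg⇒ι≤ {N} {P} {Q} P⊖N≡a =
    subst (NonNeg α β) (cong₂ _,_ (sym (trans (m-n≡m⊖n P N) P⊖N≡a)) (sym (ℤ.+-identityʳ (+ Q))))

  ι≤P+Qγ : ∀ {N P Q} → 1 ≤ Q → N ∸ P ≤γ· Q → ι N ≤[ α , β ] (+ P , + Q)
  ι≤P+Qγ {N} {P} 1≤Q N∸P≤γQ with ≤-total N P
  ... | inj₁ N≤P = nonNeg⇒ι≤ {N} {P} (⊖-≥ N≤P) (inj₂ (inj₁ (+<+ 1≤Q , inj₁ (+≤+ z≤n))))
  ... | inj₂ P≤N = nonNeg⇒ι≤ {N} {P} (⊖-≤ P≤N) (nonNeg-[Qγ−d] 1≤Q N∸P≤γQ)

  P+Qγ≤ι : ∀ {N P Q} → 1 ≤ Q → P ≤ N → Q γ·≤ N ∸ P → (+ P , + Q) ≤[ α , β ] ι N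
  P+Qγ≤ι {N} {P} {Q} 1≤Q P≤N Qγ≤N∸P =
    subst (NonNeg α β) (cong₂ _,_ (sym (trans (m-n≡m⊖n N P) (⊖-≥ P≤N))) (sym (ℤ.+-identityˡ (ℤ.- + Q))))
      (nonNeg-[c−Qγ] 1≤Q Qγ≤N∸P)

  IsS⇒≥ : ∀ k {n} → IsS α β n (suc (suc k)) → β * U k + U (suc k) ≤ n
  IsS⇒≥ k {n} ((a₁ , a₂ , 1≤a₁ , 1≤a₂ , _ , walk≡n) , _) = begin
    β * U k + U (suc k)              ≡⟨ cong₂ _+_ (*-identityʳ (β * U k)) (*-identityʳ (U (suc k))) ⟨
    β * U k * 1 + U (suc k) * 1      ≤⟨ +-mono-≤ (*-monoʳ-≤ (β * U k) 1≤a₁) (*-monoʳ-≤ (U (suc k)) 1≤a₂) ⟩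
    β * U k * a₁ + U (suc k) * a₂    ≡⟨ walk≡U-expansion a₁ a₂ k ⟨
    walk α β a₁ a₂ (suc (suc k))     ≡⟨ walk≡n ⟩
    n                                ∎
    where open ≤-Reasoning

  module _ (α⊥β : Coprime α β) where

    coprime-β-U : ∀ k → Coprime β (U (suc k))
    coprime-β-U zero (_ , d∣1) = ∣1⇒≡1 d∣1
    coprime-β-U (suc k) {d} (d∣β , d∣U) = coprime-* α⊥β (Coprime.sym (coprime-β-U k)) (d∣αU , d∣β)
      where
      d∣αU : d ∣ α * U (suc k)
      d∣αU = ∣m+n∣m⇒∣n (subst (d ∣_) (+-comm (α * U (suc k)) (β * U k)) d∣U)
                        (∣-trans d∣β (m∣m*n (U k)))

    coprime-U-U : ∀ k → Coprime (U k) (U (suc k))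
    coprime-βU-U : ∀ k → Coprime (β * U k) (U (suc k))

    coprime-U-U zero (_ , d∣1) = ∣1⇒≡1 d∣1
    coprime-U-U (suc k) (d∣U , d∣U′) = coprime-βU-U k (∣m+n∣m⇒∣n d∣U′ (∣n⇒∣m*n α d∣U) , d∣U)

    coprime-βU-U k = coprime-* (coprime-β-U k) (coprime-U-U k)

  module _ (α≥1 : 1 ≤ α) where

    U-≤-suc : ∀ k → U k ≤ U (suc k)
    U-≤-suc zero = z≤n
    U-≤-suc (suc k) = ≤-trans (m≤n*m (U (suc k)) α {{>-nonZero α≥1}}) (m≤m+n _ _)

    U-≤-+ : ∀ d m → U m ≤ U (d + m)
    U-≤-+ zero m = ≤-refl
    U-≤-+ (suc d) m = ≤-trans (U-≤-+ d m) (U-≤-suc (d + m))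

    U-pos : ∀ k → 1 ≤ U (suc k)
    U-pos zero = ≤-refl
    U-pos (suc k) = ≤-trans (U-pos k) (U-≤-suc (suc k))

    ι≤γ^ : ∀ k {N} → N ≤ U (suc (suc k)) → ι N ≤[ α , β ] γ^ α β (suc k)
    ι≤γ^ k {N} N≤U = subst (ι N ≤[ α , β ]_) (sym (γ^≡U k))
      (ι≤P+Qγ {N} {β * U k} (U-pos k) (≤-≤γ·-trans N∸βU≤αU (α*Q≤γ·Q (U (suc k)))))
      where
      N∸βU≤αU : N ∸ β * U k ≤ α * U (suc k)
      N∸βU≤αU = m≤n+o⇒m∸n≤o N (β * U k)
        (≤-trans N≤U (≤-reflexive (+-comm (α * U (suc k)) (β * U k))))

    γ^≤ι : ∀ k {N} → β * U (suc k) + U (suc (suc k)) ≤ N → γ^ α β (suc k) ≤[ α , β ] ι N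
    γ^≤ι k {N} h = subst (_≤[ α , β ] ι N) (sym (γ^≡U k))
      (P+Qγ≤ι {N} {β * U k} (U-pos k) (≤-trans (m≤n+m _ _) h′)
        ([α+β]*Q≤⇒γ·≤ (≤-trans α≥1 (m≤m+n α β)) (m+n≤o⇒m≤o∸n _ h′)))
      where
      regroup : ∀ u v → (α + β) * v + β * u ≡ β * v + (α * v + β * u)
      regroup u v = solve (α ∷ β ∷ u ∷ v ∷ [])
      h′ : (α + β) * U (suc k) + β * U k ≤ N
      h′ = ≤-trans (≤-reflexive (regroup (U k) (U (suc k)))) h

    module _ (α⊥β : Coprime α β) where

      walk-hits : ∀ k {n} → β * U k * U (suc k) < n →
        ∃₂ λ a₁ a₂ → 1 ≤ a₁ × 1 ≤ a₂ × walk α β a₁ a₂ (suc (suc k)) ≡ n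
      walk-hits k n> with coprime-positive-combination {{>-nonZero (U-pos k)}} (coprime-βU-U α⊥β k) n>
      ... | a₁ , a₂ , 1≤a₁ , 1≤a₂ , combination≡n =
        a₁ , a₂ , 1≤a₁ , 1≤a₂ , trans (walk≡U-expansion a₁ a₂ k) combination≡n

      IsS⇒≤ : ∀ k {n} → IsS α β n (suc k) → n ≤ β * U k * U (suc k)
      IsS⇒≤ k {n} (_ , maximal) = ≮⇒≥ n≯
        where
        n≯ : ¬ (β * U k * U (suc k) < n)
        n≯ n> with walk-hits k n>
        ... | a₁ , a₂ , 1≤a₁ , 1≤a₂ , hit =
          1+n≰n (maximal a₁ a₂ (suc (suc k)) 1≤a₁ 1≤a₂ (s≤s z≤n) hit)

  golden-ratio-bound : α ≡ 1 → β ≡ 1 → ∀ t {n} → n ≤ β * U (suc (suc t)) * U (suc (suc (suc t))) →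
    ι n ≤[ α , β ] γ^ α β (suc (suc t + t))
  golden-ratio-bound refl refl t {n} n≤ = subst (ι n ≤[ 1 , 1 ]_) (sym (γ^≡U (suc t + t)))
    (ι≤P+Qγ {n} {P} (U-pos ≤-refl (suc t + t)) (≤-≤γ·-trans n∸P≤Q+uv Q+uv≤γQ))
    where
    open ≤-Reasoning
    u v P Q : ℕ
    u = U t
    v = U (suc t)
    P = 1 * U (suc t + t)
    Q = U (suc (suc t) + t)
    P≡u²+v² : P ≡ u * u + v * v
    P≡u²+v² = trans (cong (1 *_) (U-addition t t)) (identity u v)
      where
      identity : ∀ u v → 1 * (1 * u * u + v * v) ≡ u * u + v * v
      identity u v = solve (u ∷ v ∷ [])
    Q≡v[v+2u] : Q ≡ v * (v + 2 * u)
    Q≡v[v+2u] = trans (U-addition (suc t) t) (identity u v)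
      where
      identity : ∀ u v → 1 * v * u + (1 * v + 1 * u) * v ≡ v * (v + 2 * u)
      identity u v = solve (u ∷ v ∷ [])
    n∸P≤Q+uv : n ∸ P ≤ Q + u * v
    n∸P≤Q+uv = m≤n+o⇒m∸n≤o n P (begin
      n                                                      ≤⟨ n≤ ⟩
      1 * (1 * v + 1 * u) * (1 * (1 * v + 1 * u) + 1 * v)    ≡⟨ identity u v ⟩
      (u * u + v * v) + (v * (v + 2 * u) + u * v)            ≡⟨ cong₂ (λ p q → p + (q + u * v)) P≡u²+v² Q≡v[v+2u] ⟨
      P + (Q + u * v)                                        ∎)
      where
      identity : ∀ u v → 1 * (1 * v + 1 * u) * (1 * (1 * v + 1 * u) + 1 * v)
                       ≡ (u * u + v * v) + (v * (v + 2 * u) + u * v)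
      identity u v = solve (u ∷ v ∷ [])
    ≤γ·-criterion : ∀ q w → w * (q + w) ≤ q * q → q + w ≤γ· q
    ≤γ·-criterion q w w[q+w]≤q² = begin
      (q + w) * (q + w)                   ≡⟨ solve (q ∷ w ∷ []) ⟩
      q * q + q * w + w * (q + w)         ≤⟨ +-monoʳ-≤ (q * q + q * w) w[q+w]≤q² ⟩
      q * q + q * w + q * q               ≡⟨ solve (q ∷ w ∷ []) ⟩
      1 * q * q + 1 * (q + w) * q         ∎
    uv[Q+uv]≤Q² : ∀ u v → u * v * (v * (v + 2 * u) + u * v) ≤ v * (v + 2 * u) * (v * (v + 2 * u))
    uv[Q+uv]≤Q² u v = begin
      u * v * (v * (v + 2 * u) + u * v)                                         ≤⟨ m≤m+n _ _ ⟩
      u * v * (v * (v + 2 * u) + u * v) + v * v * (v * v + 3 * u * v + u * u)   ≡⟨ solve (u ∷ v ∷ []) ⟩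
      v * (v + 2 * u) * (v * (v + 2 * u))                                       ∎
    Q+uv≤γQ : Q + u * v ≤γ· Q
    Q+uv≤γQ = subst (λ q → q + u * v ≤γ· q) (sym Q≡v[v+2u])
      (≤γ·-criterion (v * (v + 2 * u)) (u * v) (uv[Q+uv]≤Q² u v))

proposition1 : (α β : ℕ) → 1 ≤ α → 1 ≤ β → Coprime α β →
    (n s : ℕ) → 1 ≤ n → IsS α β n s → 2 < s →
    (ι n ≤[ α , β ] γ^ α β (2 * s + 2))
    × (γ^ α β (s ∸ 2) ≤[ α , β ] ι n)
    × (α ≡ 1 → β ≡ 1 → ι n ≤[ α , β ] γ^ α β (2 * s ∸ 4))
proposition1 α β α≥1 _ α⊥β n s@(suc (suc (suc t))) _ isS (s≤s (s≤s (s≤s _))) = upper , lower , golden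
  where
  n≤βUU : n ≤ β * U α β (suc (suc t)) * U α β s
  n≤βUU = IsS⇒≤ α β α≥1 α⊥β (suc (suc t)) isS
  upper : ι n ≤[ α , β ] γ^ α β (2 * s + 2)
  upper = subst (λ i → ι n ≤[ α , β ] γ^ α β i) (index s)
    (ι≤γ^ α β α≥1 (suc (s + s))
      (≤-trans n≤βUU (≤-trans (β*U*U≤U α β (suc (suc t))) (U-≤-+ α β α≥1 3 (s + s)))))
    where
    index : ∀ s → 2 + (s + s) ≡ 2 * s + 2
    index = solve-∀
  lower : γ^ α β (s ∸ 2) ≤[ α , β ] ι n
  lower = γ^≤ι α β α≥1 t (IsS⇒≥ α β (suc t) isS)
  golden : α ≡ 1 → β ≡ 1 → ι n ≤[ α , β ] γ^ α β (2 * s ∸ 4)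
  golden α≡1 β≡1 = subst (λ i → ι n ≤[ α , β ] γ^ α β (i ∸ 4)) (sym (index t))
    (golden-ratio-bound α β α≡1 β≡1 t n≤βUU)
    where
    index : ∀ t → 2 * (3 + t) ≡ 4 + suc (suc t + t)
    index = solve-∀
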